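{- Let $k$ be an odd positive integer and let $G$ be a maximal $k$-degenerate graph. Then $\chi_o(G)\le 2k+1$.
   Context: All graphs are finite, simple and undirected. A graph is $k$-degenerate if every induced subgraph has a vertex of degree at most $k$; it is maximal $k$-degenerate if it is $k$-degenerate and adding any new edge yields a graph that is not $k$-degenerate. (Equivalently, a maximal $k$-degenerate graph with at least $k+1$ vertices is one obtained from $K_{k+1}$ by repeatedly adding a new vertex adjacent to exactly $k$ existing vertices.) A proper vertex coloring $\varphi$ of a graph $G$ is called an odd coloring if for every non-isolated vertex $x$ of $G$ there is a color $c$ such that the number of neighbors $y\in N(x)$ with $\varphi(y)=c$ is odd. The odd chromatic number $\chi_o(G)$ is the minimum number of colors in an odd coloring of $G$. -}

module Defs where

open import Data.Nat using (ℕ; zero; suc; _+_; _≤_; _%_)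
open import Data.Fin using (Fin; zero; suc; _≟_)
open import Data.Bool using (Bool; true; false; _∧_; _∨_; if_then_else_)
open import Data.Product using (∃; _×_; _,_)
open import Relation.Binary.PropositionalEquality using (_≡_; _≢_)
open import Relation.Nullary using (¬_; does)

count : ∀ {n} → (Fin n → Bool) → ℕ
count {zero}  P = 0
count {suc n} P = (if P zero then 1 else 0) + count (λ i → P (suc i))

Adj : ℕ → Set
Adj n = Fin n → Fin n → Bool

record Graph (n : ℕ) : Set where
  field
    adj    : Adj n
    sym    : ∀ x y → adj x y ≡ adj y x
    irrefl : ∀ x → adj x x ≡ false
open Graph public

degIn : ∀ {n} → Adj n → (Fin n → Bool) → Fin n → ℕ
degIn A S v = count (λ u → S u ∧ A v u)

Degenerate : ℕ → ∀ {n} → Adj n → Set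
Degenerate k {n} A = (S : Fin n → Bool) → (∃ λ x → S x ≡ true) →
  ∃ λ v → (S v ≡ true) × (degIn A S v ≤ k)

-- adjacency of G + xy (a simple graph when x ≢ y)
addEdge : ∀ {n} → Adj n → Fin n → Fin n → Adj n
addEdge A x y u v =
  A u v ∨ ((does (u ≟ x) ∧ does (v ≟ y)) ∨ (does (u ≟ y) ∧ does (v ≟ x)))

MaximalDegenerate : ℕ → ∀ {n} → Graph n → Set
MaximalDegenerate k {n} G =
  Degenerate k (adj G) ×
  ((x y : Fin n) → x ≢ y → adj G x y ≡ false →
     ¬ Degenerate k (addEdge (adj G) x y))

record OddColoring {n} (G : Graph n) (c : ℕ) : Set where
  field
    color  : Fin n → Fin c
    proper : ∀ x y → adj G x y ≡ true → color x ≢ color y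
    odd    : ∀ x → (∃ λ y → adj G x y ≡ true) →
             ∃ λ (col : Fin c) →
               count (λ y → adj G x y ∧ does (color y ≟ col)) % 2 ≡ 1

-- χ_o(G) ≤ c : G has an odd coloring using at most c colors
-- (equivalently, one with colors drawn from Fin c)
OddChromaticAtMost : ∀ {n} → Graph n → ℕ → Set
OddChromaticAtMost G c = OddColoring G c

{-# OPTIONS --safe #-}
-- Induction over the induced subgraphs G[T] that are maximal k-degenerate. A vertex v of
-- minimum degree d ≤ k can be deleted without losing maximality. If |T| ≤ k + 1 then G[T] is
-- complete, since every missing edge could be added; otherwise d = k, since for d < k an edge
-- from v to a non-neighbour could be added. Extend an odd colouring of G[T - v] by giving v a
-- colour that differs from the colours and the odd colours of its d neighbours (2d < 2k + 1).
-- Then v sees an odd colour class: for d = k odd by parity, and in a complete graph because its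
-- neighbours are coloured pairwise differently. A neighbour x of v keeps its odd colour, which v
-- does not use, unless v is the only neighbour of x, in which case the colour of v is odd at x.

module Submission where

open import Defs
open import Data.Nat using (ℕ; _+_; _*_; _%_)
open import Relation.Binary.PropositionalEquality using (_≡_)

open import Data.Bool using (Bool; true; false; _∧_; _∨_; not; if_then_else_)
open import Data.Bool.Properties using (∨-identityʳ; ∨-zeroʳ; ∧-zeroʳ)
import Data.Bool.Properties as Bool
open import Data.Vec.Functional using (updateAt)
open import Data.Vec.Functional.Properties using (updateAt-updates; updateAt-minimal)
open import Data.Fin using (Fin; zero; suc; _≟_; fromℕ<)
open import Data.Fin.Properties using (¬∀⟶∃¬; any?)
open import Data.Nat using (suc; _≤_; _<_; z≤n; s≤s; s≤s⁻¹)
import Data.Nat as ℕ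
open import Data.Nat.DivMod using (%-distribˡ-+; m%n<n)
open import Data.Nat.Properties
  using (≤-trans; ≤-reflexive; ≤-<-trans; ≤-antisym; ≮⇒≥; <-asym; ≰⇒>; _≤?_; m≤n⇒m≤1+n; n≤1+n;
         suc-injective; 0≢1+n; +-identityʳ; +-suc; +-comm; +-monoʳ-≤; +-mono-≤;
         +-0-commutativeMonoid; +-commutativeSemigroup; module ≤-Reasoning)
open import Algebra.Properties.CommutativeMonoid.Sum +-0-commutativeMonoid
  using (sum-syntax; ∑-comm; sum-cong-≗; sum-replicate-zero)
open import Algebra.Properties.CommutativeSemigroup +-commutativeSemigroup using (x∙yz≈y∙xz)
open import Data.Product using (Σ; ∃; _×_; _,_; proj₁; proj₂)
open import Function using (_∘_; mk⇔)
open import Relation.Binary.PropositionalEquality using (refl; trans; cong; cong₂; subst; _≢_; module ≡-Reasoning)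
import Relation.Binary.PropositionalEquality as ≡
open import Relation.Nullary using (¬_; does; yes; no; contradiction)
open import Relation.Nullary.Decidable using (dec-true; dec-false; does-⇔)

indicator : Bool → ℕ
indicator b = if b then 1 else 0

-- The conjunct order makes (p - x) y compute when x and y are constructors.
infixl 6 _-_
_-_ : ∀ {n} → (Fin n → Bool) → Fin n → Fin n → Bool
(p - x) y = not (does (x ≟ y)) ∧ p y

infix 4 _⊆_
_⊆_ : ∀ {n} → (Fin n → Bool) → (Fin n → Bool) → Set
S ⊆ T = ∀ x → S x ≡ true → T x ≡ true

∧-true⁻ : ∀ {a b} → a ∧ b ≡ true → a ≡ true × b ≡ true
∧-true⁻ {true} b≡true = refl , b≡true

∧-true⁺ : ∀ {a b} → a ≡ true → b ≡ true → a ∧ b ≡ true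
∧-true⁺ refl refl = refl

∨-false⁻ : ∀ {a b} → a ∨ b ≡ false → a ≡ false × b ≡ false
∨-false⁻ {false} b≡false = refl , b≡false

does-≟-sym : ∀ {n} (x y : Fin n) → does (x ≟ y) ≡ does (y ≟ x)
does-≟-sym x y = does-⇔ (mk⇔ ≡.sym ≡.sym) (x ≟ y) (y ≟ x)

p-x⊆p : ∀ {n} (p : Fin n → Bool) x → p - x ⊆ p
p-x⊆p p x y = proj₂ ∘ ∧-true⁻

y∈p⇒y∈p-x : ∀ {n} (p : Fin n → Bool) x {y} → p y ≡ true → y ≢ x → (p - x) y ≡ true
y∈p⇒y∈p-x p x {y} py y≢x rewrite dec-false (x ≟ y) (y≢x ∘ ≡.sym) = py

x∉p-x : ∀ {n} (p : Fin n → Bool) x → (p - x) x ≡ false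
x∉p-x p x rewrite dec-true (x ≟ x) refl = refl

y∈p-x⇒x≢y : ∀ {n} (p : Fin n → Bool) x {y} → (p - x) y ≡ true → x ≢ y
y∈p-x⇒x≢y p x p-x∋y refl = contradiction (trans (≡.sym (x∉p-x p x)) p-x∋y) λ ()

⊆-false : ∀ {n} {S T : Fin n → Bool} {x} → S ⊆ T → T x ≡ false → S x ≡ false
⊆-false {S = S} {x = x} S⊆T Tx with S x in Sx
... | false = refl
... | true  = contradiction (trans (≡.sym (S⊆T x Sx)) Tx) λ ()

-- Counting

count-cong : ∀ {n} {P Q : Fin n → Bool} → (∀ i → P i ≡ Q i) → count P ≡ count Q
count-cong {ℕ.zero} _   = refl
count-cong {suc n}  P≗Q = cong₂ _+_ (cong indicator (P≗Q zero)) (count-cong (P≗Q ∘ suc))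

count-mono : ∀ {n} {P Q : Fin n → Bool} → P ⊆ Q → count P ≤ count Q
count-mono {ℕ.zero} _ = z≤n
count-mono {suc n} {P} {Q} P⊆Q with P zero in p₀ | Q zero in q₀
... | false | false = count-mono (P⊆Q ∘ suc)
... | false | true  = m≤n⇒m≤1+n (count-mono (P⊆Q ∘ suc))
... | true  | true  = s≤s (count-mono (P⊆Q ∘ suc))
... | true  | false = contradiction (trans (≡.sym (P⊆Q zero p₀)) q₀) λ ()

count-∨ : ∀ {n} (P Q : Fin n → Bool) → count (λ i → P i ∨ Q i) ≤ count P + count Q
count-∨ {ℕ.zero} _ _ = z≤n
count-∨ {suc n} P Q with P zero | Q zero | count-∨ (P ∘ suc) (Q ∘ suc)
... | false | false | ih = ih
... | false | true  | ih = ≤-trans (s≤s ih) (≤-reflexive (≡.sym (+-suc _ _)))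
... | true  | false | ih = s≤s ih
... | true  | true  | ih = s≤s (≤-trans ih (+-monoʳ-≤ _ (n≤1+n _)))

count-none : ∀ {n} {P : Fin n → Bool} → (∀ i → P i ≡ false) → count P ≡ 0
count-none {ℕ.zero} _ = refl
count-none {suc n} none rewrite none zero = count-none (none ∘ suc)

count-singleton : ∀ {n} (y : Fin n) → count (λ i → does (y ≟ i)) ≡ 1
count-singleton {suc n} zero = cong suc (count-none {n} λ _ → refl)
count-singleton {suc n} (suc y) = count-singleton y

count-remove : ∀ {n} (P : Fin n → Bool) v → count P ≡ indicator (P v) + count (P - v)
count-remove P zero    = refl
count-remove P (suc v) = begin
  indicator (P zero) + count (P ∘ suc)
    ≡⟨ cong (indicator (P zero) +_) (count-remove (P ∘ suc) v) ⟩
  indicator (P zero) + (indicator (P (suc v)) + count (P ∘ suc - v))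
    ≡⟨ x∙yz≈y∙xz (indicator (P zero)) (indicator (P (suc v))) _ ⟩
  indicator (P (suc v)) + (indicator (P zero) + count (P ∘ suc - v))
    ∎
  where open ≡-Reasoning

count-remove-∈ : ∀ {n} (P : Fin n → Bool) {v} → P v ≡ true → count P ≡ suc (count (P - v))
count-remove-∈ P {v} Pv = trans (count-remove P v) (cong (λ b → indicator b + count (P - v)) Pv)

count-pos⇒∃ : ∀ {n} {P : Fin n → Bool} → 0 < count P → ∃ λ i → P i ≡ true
count-pos⇒∃ {suc n} {P} 0<count with P zero in p₀
... | true  = zero , p₀
... | false = let i , Pi = count-pos⇒∃ 0<count in suc i , Pi

count<n⇒∃ : ∀ {n} {P : Fin n → Bool} → count P < n → ∃ λ i → P i ≡ false
count<n⇒∃ {suc n} {P} count<n with P zero in p₀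
... | false = zero , p₀
... | true  = let i , Pi = count<n⇒∃ (s≤s⁻¹ count<n) in suc i , Pi

count≡∑ : ∀ {n} (P : Fin n → Bool) → count P ≡ ∑[ i < n ] indicator (P i)
count≡∑ {ℕ.zero} _ = refl
count≡∑ {suc n}  P = cong (indicator (P zero) +_) (count≡∑ (P ∘ suc))

indicator≡∑ : ∀ {C} b (x : Fin C) → indicator b ≡ ∑[ c < C ] indicator (b ∧ does (x ≟ c))
indicator≡∑ {C} false x = ≡.sym (sum-replicate-zero C)
indicator≡∑     true  x = ≡.sym (trans (≡.sym (count≡∑ (λ c → does (x ≟ c)))) (count-singleton x))

count-partition : ∀ {n C} (P : Fin n → Bool) (col : Fin n → Fin C) →
  count P ≡ ∑[ c < C ] count (λ y → P y ∧ does (col y ≟ c))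
count-partition {n} {C} P col = begin
  count P                                          ≡⟨ count≡∑ P ⟩
  ∑[ y < n ] indicator (P y)                       ≡⟨ sum-cong-≗ (λ y → indicator≡∑ (P y) (col y)) ⟩
  ∑[ y < n ] ∑[ c < C ] χ y c                      ≡⟨ ∑-comm χ ⟩
  ∑[ c < C ] ∑[ y < n ] χ y c                      ≡⟨ sum-cong-≗ (λ c → ≡.sym (count≡∑ (λ y → P y ∧ does (col y ≟ c)))) ⟩
  ∑[ c < C ] count (λ y → P y ∧ does (col y ≟ c))  ∎
  where
  open ≡-Reasoning
  χ : Fin n → Fin C → ℕ
  χ y c = indicator (P y ∧ does (col y ≟ c))

∑-even : ∀ {C} (f : Fin C → ℕ) → (∀ c → f c % 2 ≡ 0) → (∑[ c < C ] f c) % 2 ≡ 0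
∑-even {ℕ.zero} _ _    = refl
∑-even {suc C}  f even = trans (%-distribˡ-+ (f zero) (∑[ c < C ] f (suc c)) 2)
  (cong₂ (λ a b → (a + b) % 2) (even zero) (∑-even (f ∘ suc) (even ∘ suc)))

%2≢0⇒%2≡1 : ∀ m → m % 2 ≢ 0 → m % 2 ≡ 1
%2≢0⇒%2≡1 m m%2≢0 with m % 2 | m%n<n m 2
... | 0           | _               = contradiction refl m%2≢0
... | 1           | _               = refl
... | suc (suc _) | s≤s (s≤s ())

odd-count⇒odd-class : ∀ {n C} (P : Fin n → Bool) (col : Fin n → Fin C) → count P % 2 ≡ 1 →
  ∃ λ c → count (λ y → P y ∧ does (col y ≟ c)) % 2 ≡ 1
odd-count⇒odd-class {C = C} P col odd =
  let c , class-odd = ¬∀⟶∃¬ C (λ c → class c % 2 ≡ 0) (λ c → class c % 2 ℕ.≟ 0) not-all-even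
  in  c , %2≢0⇒%2≡1 (class c) class-odd
  where
  class : Fin C → ℕ
  class c = count (λ y → P y ∧ does (col y ≟ c))
  not-all-even : ¬ (∀ c → class c % 2 ≡ 0)
  not-all-even even = 0≢1+n (trans (≡.sym (∑-even class even)) (trans (cong (_% 2) (≡.sym (count-partition P col))) odd))

count-∨-singleton : ∀ {n} (P : Fin n → Bool) y → count (λ w → P w ∨ does (y ≟ w)) ≤ suc (count P)
count-∨-singleton P y = begin
  count (λ w → P w ∨ does (y ≟ w))        ≤⟨ count-∨ P (λ w → does (y ≟ w)) ⟩
  count P + count (λ w → does (y ≟ w))    ≡⟨ cong (count P +_) (count-singleton y) ⟩
  count P + 1                             ≡⟨ +-comm (count P) 1 ⟩
  suc (count P)                           ∎
  where open ≤-Reasoning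

image : ∀ {n C} → (Fin n → Bool) → (Fin n → Fin C) → Fin C → Bool
image {ℕ.zero} _ _ _ = false
image {suc n}  N f c = image (N ∘ suc) (f ∘ suc) c ∨ (N zero ∧ does (f zero ≟ c))

count-image : ∀ {n C} (N : Fin n → Bool) (f : Fin n → Fin C) → count (image N f) ≤ count N
count-image {ℕ.zero} N f = ≤-reflexive (count-none {P = image N f} λ _ → refl)
count-image {suc n}  N f with N zero
... | false = ≤-trans (≤-reflexive (count-cong λ c → ∨-identityʳ (image (N ∘ suc) (f ∘ suc) c)))
                      (count-image (N ∘ suc) (f ∘ suc))
... | true  = ≤-trans (count-∨-singleton (image (N ∘ suc) (f ∘ suc)) (f zero))
                      (s≤s (count-image (N ∘ suc) (f ∘ suc)))

image-∋ : ∀ {n C} (N : Fin n → Bool) (f : Fin n → Fin C) {u} → N u ≡ true → image N f (f u) ≡ true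
image-∋ N f {zero}  Nu rewrite Nu | dec-true (f zero ≟ f zero) refl = ∨-zeroʳ _
image-∋ N f {suc u} Nu rewrite image-∋ (N ∘ suc) (f ∘ suc) Nu = refl

free-colour : ∀ {n C} (N : Fin n → Bool) (f g : Fin n → Fin C) → count N + count N < C →
  ∃ λ c → ∀ u → N u ≡ true → c ≢ f u × c ≢ g u
free-colour N f g 2|N|<C
  with count<n⇒∃ {P = λ c → image N f c ∨ image N g c}
         (≤-<-trans (≤-trans (count-∨ (image N f) (image N g)) (+-mono-≤ (count-image N f) (count-image N g))) 2|N|<C)
... | c , c∉ = let c∉f , c∉g = ∨-false⁻ c∉ in c , λ u Nu → ∉image f c∉f Nu , ∉image g c∉g Nu
  where
  ∉image : ∀ h {c u} → image N h c ≡ false → N u ≡ true → c ≢ h u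
  ∉image h c∉ Nu refl = contradiction (trans (≡.sym (image-∋ N h Nu)) c∉) λ ()

-- Degrees and adding an edge

degIn-mono : ∀ {n} (A : Adj n) {S T : Fin n → Bool} u → S ⊆ T → degIn A S u ≤ degIn A T u
degIn-mono A {S} {T} u S⊆T = count-mono {P = λ w → S w ∧ A u w} {Q = λ w → T w ∧ A u w}
  λ w h → let Sw , Auw = ∧-true⁻ h in ∧-true⁺ (S⊆T w Sw) Auw

degIn<count : ∀ {n} {A : Adj n} {S T : Fin n → Bool} {u} →
  A u u ≡ false → S ⊆ T → S u ≡ true → degIn A S u < count T
degIn<count {A = A} {S} {T} {u} Auu S⊆T Su = begin-strict
  degIn A S u          <⟨ s≤s (count-mono {P = λ w → S w ∧ A u w} {Q = T - u} nbr∈T-u) ⟩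
  suc (count (T - u))  ≡⟨ ≡.sym (count-remove-∈ T (S⊆T u Su)) ⟩
  count T              ∎
  where
  open ≤-Reasoning
  nbr∈T-u : (λ w → S w ∧ A u w) ⊆ T - u
  nbr∈T-u w h with ∧-true⁻ h
  ... | Sw , Auw = y∈p⇒y∈p-x T u (S⊆T w Sw) λ { refl → contradiction (trans (≡.sym Auw) Auu) λ () }

module _ {n} (A : Adj n) {x y : Fin n} where

  addEdge-irrefl : (∀ u → A u u ≡ false) → x ≢ y → ∀ u → addEdge A x y u u ≡ false
  addEdge-irrefl irr x≢y u rewrite irr u with u ≟ x | u ≟ y
  ... | yes refl | yes refl = contradiction refl x≢y
  ... | yes refl | no _     = refl
  ... | no _     | yes refl = refl
  ... | no _     | no _     = refl

  addEdge-away : ∀ {u} → u ≢ x → u ≢ y → ∀ w → addEdge A x y u w ≡ A u w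
  addEdge-away {u} u≢x u≢y w rewrite dec-false (u ≟ x) u≢x | dec-false (u ≟ y) u≢y = ∨-identityʳ (A u w)

  addEdge-avoiding : ∀ {u w} → u ≢ x → w ≢ x → addEdge A x y u w ≡ A u w
  addEdge-avoiding {u} {w} u≢x w≢x
    rewrite dec-false (u ≟ x) u≢x | dec-false (w ≟ x) w≢x | ∧-zeroʳ (does (u ≟ y)) = ∨-identityʳ (A u w)

  addEdge-row : x ≢ y → ∀ w → addEdge A x y x w ≡ A x w ∨ does (y ≟ w)
  addEdge-row x≢y w rewrite dec-true (x ≟ x) refl | dec-false (x ≟ y) x≢y | ∨-identityʳ (does (w ≟ y)) =
    cong (A x w ∨_) (does-≟-sym w y)

  degIn-addEdge-away : ∀ S {u} → u ≢ x → u ≢ y → degIn (addEdge A x y) S u ≡ degIn A S u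
  degIn-addEdge-away S u≢x u≢y = count-cong λ w → cong (S w ∧_) (addEdge-away u≢x u≢y w)

  degIn-addEdge-outside : ∀ S {u} → S x ≡ false → S u ≡ true → degIn (addEdge A x y) S u ≡ degIn A S u
  degIn-addEdge-outside S {u} Sx Su = count-cong same
    where
    ∈S⇒≢x : ∀ {w} → S w ≡ true → w ≢ x
    ∈S⇒≢x Sw refl = contradiction (trans (≡.sym Sw) Sx) λ ()
    same : ∀ w → S w ∧ addEdge A x y u w ≡ S w ∧ A u w
    same w with S w in Sw
    ... | false = refl
    ... | true  = addEdge-avoiding (∈S⇒≢x Su) (∈S⇒≢x Sw)

  degIn-addEdge-≤ : ∀ S → x ≢ y → degIn (addEdge A x y) S x ≤ suc (degIn A S x)
  degIn-addEdge-≤ S x≢y = begin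
    count (λ w → S w ∧ addEdge A x y x w)          ≡⟨ count-cong (λ w → cong (S w ∧_) (addEdge-row x≢y w)) ⟩
    count (λ w → S w ∧ (A x w ∨ does (y ≟ w)))     ≤⟨ count-mono (λ w → weaken (S w) (A x w) (does (y ≟ w))) ⟩
    count (λ w → (S w ∧ A x w) ∨ does (y ≟ w))     ≤⟨ count-∨-singleton (λ w → S w ∧ A x w) y ⟩
    suc (degIn A S x)                               ∎
    where
    open ≤-Reasoning
    weaken : ∀ s a b → s ∧ (a ∨ b) ≡ true → (s ∧ a) ∨ b ≡ true
    weaken true  _ _ h  = h
    weaken false _ _ ()

-- Induced subgraphs G[T] are represented by their vertex sets T.

module _ (k : ℕ) {n : ℕ} where

  DegenerateOn : Adj n → (Fin n → Bool) → Set
  DegenerateOn A T = ∀ S → S ⊆ T → (∃ λ x → S x ≡ true) → ∃ λ v → S v ≡ true × degIn A S v ≤ k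

  DegenerateOn-⊆ : ∀ {A T T′} → T′ ⊆ T → DegenerateOn A T → DegenerateOn A T′
  DegenerateOn-⊆ T′⊆T D S S⊆T′ = D S (λ x → T′⊆T x ∘ S⊆T′ x)

  DegenerateOn-small : ∀ {A T} → (∀ u → A u u ≡ false) → count T ≤ suc k → DegenerateOn A T
  DegenerateOn-small {A} {T} irr |T|≤1+k S S⊆T (u , Su) =
    u , Su , s≤s⁻¹ (≤-trans (degIn<count {A = A} {S} {T} (irr u) S⊆T Su) |T|≤1+k)

  DegenerateOn-insert : ∀ {A T} v → (∀ S → S ⊆ T → S v ≡ true → degIn A S v ≤ k) →
    DegenerateOn A (T - v) → DegenerateOn A T
  DegenerateOn-insert {T = T} v v-low D S S⊆T S≢∅ with S v in Sv
  ... | true  = v , Sv , v-low S S⊆T Sv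
  ... | false = D S (λ x Sx → y∈p⇒y∈p-x T v (S⊆T x Sx) λ { refl → contradiction (trans (≡.sym Sx) Sv) λ () })
                    S≢∅

  DegenerateOn-addEdge-outside : ∀ {A T x y} → T x ≡ false → DegenerateOn A T → DegenerateOn (addEdge A x y) T
  DegenerateOn-addEdge-outside {A} {T} {x} {y} Tx D S S⊆T S≢∅ with D S S⊆T S≢∅
  ... | u , Su , deg≤k =
    u , Su , ≤-trans (≤-reflexive (degIn-addEdge-outside A {x} {y} S (⊆-false {S = S} {T} S⊆T Tx) Su)) deg≤k

-- Odd colourings of induced subgraphs

module _ {n} (G : Graph n) where

  N : (Fin n → Bool) → Fin n → Fin n → Bool
  N T x y = T y ∧ adj G x y

  multiplicity : ∀ {C} → (Fin n → Bool) → (Fin n → Fin C) → Fin n → Fin C → ℕ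
  multiplicity T col x c = count (λ y → N T x y ∧ does (col y ≟ c))

  HasNeighbour : (Fin n → Bool) → Fin n → Set
  HasNeighbour T x = ∃ λ y → N T x y ≡ true

  ProperOn : ∀ {C} → (Fin n → Bool) → (Fin n → Fin C) → Set
  ProperOn T col = ∀ x y → T x ≡ true → T y ≡ true → adj G x y ≡ true → col x ≢ col y

  IsClique : (Fin n → Bool) → Set
  IsClique T = ∀ x y → T x ≡ true → T y ≡ true → x ≢ y → adj G x y ≡ true

  record OddColoringOn (T : Fin n → Bool) (C : ℕ) : Set where
    field
      color    : Fin n → Fin C
      proper   : ProperOn T color
      -- kept as data so that a new vertex can avoid it
      oddColor : Fin n → Fin C
      odd      : ∀ x → T x ≡ true → HasNeighbour T x → multiplicity T color x (oddColor x) % 2 ≡ 1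

  OddUnderEveryProper : ℕ → (Fin n → Bool) → Fin n → Set
  OddUnderEveryProper C T v = (col : Fin n → Fin C) → ProperOn T col →
    Σ (Fin C) λ c → HasNeighbour T v → multiplicity T col v c % 2 ≡ 1

  odd-degree⇒OddUnderEveryProper : ∀ {C} T v → degIn (adj G) T v % 2 ≡ 1 → OddUnderEveryProper C T v
  odd-degree⇒OddUnderEveryProper T v odd col _ with odd-count⇒odd-class (N T v) col odd
  ... | c , c-odd = c , λ _ → c-odd

  clique⇒OddUnderEveryProper : ∀ {C} T v → IsClique T → OddUnderEveryProper C T v
  clique⇒OddUnderEveryProper T v clique col proper with any? (λ y → N T v y Bool.≟ true)
  ... | no  isolated = col v , λ has → contradiction has isolated
  ... | yes (y , vy) = col y , λ _ → cong (_% 2) (trans (count-cong only-y) (count-singleton y))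
    where
    only-y : ∀ z → N T v z ∧ does (col z ≟ col y) ≡ does (y ≟ z)
    only-y z with y ≟ z
    ... | yes refl rewrite vy = dec-true (col y ≟ col y) refl
    ... | no y≢z with N T v z in vz
    ... | false = refl
    ... | true  = dec-false (col z ≟ col y) (proper z y Tz Ty (clique z y Tz Ty (y≢z ∘ ≡.sym)))
      where
      Tz : T z ≡ true
      Tz = proj₁ (∧-true⁻ vz)
      Ty : T y ≡ true
      Ty = proj₁ (∧-true⁻ vy)

  N-sym : ∀ T {x y} → T x ≡ true → N T x y ≡ true → N T y x ≡ true
  N-sym T Tx xy = ∧-true⁺ Tx (trans (sym G _ _) (proj₂ (∧-true⁻ xy)))

  N-remove : ∀ T v {x y} → N T x y ≡ true → y ≢ v → N (T - v) x y ≡ true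
  N-remove T v xy y≢v = let Ty , Axy = ∧-true⁻ xy in ∧-true⁺ (y∈p⇒y∈p-x T v Ty y≢v) Axy

  ProperOn-insert : ∀ {C} T v (col : Fin n → Fin C) c₀ → (∀ u → N T v u ≡ true → c₀ ≢ col u) →
    ProperOn (T - v) col → ProperOn T (updateAt col v λ _ → c₀)
  ProperOn-insert T v col c₀ c₀-free proper x y Tx Ty Axy with x ≟ v | y ≟ v
  ... | yes refl | yes refl = contradiction (trans (≡.sym Axy) (irrefl G v)) λ ()
  ... | yes refl | no y≢v   = λ eq → c₀-free y (∧-true⁺ Ty Axy)
                                       (trans (≡.sym (updateAt-updates v col)) (trans eq (updateAt-minimal y v col y≢v)))
  ... | no x≢v   | yes refl = λ eq → c₀-free x (N-sym T Tx (∧-true⁺ Ty Axy))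
                                       (trans (≡.sym (updateAt-updates v col)) (trans (≡.sym eq) (updateAt-minimal x v col x≢v)))
  ... | no x≢v   | no y≢v   = λ eq → proper x y (y∈p⇒y∈p-x T v Tx x≢v) (y∈p⇒y∈p-x T v Ty y≢v) Axy
                                       (trans (≡.sym (updateAt-minimal x v col x≢v)) (trans eq (updateAt-minimal y v col y≢v)))

  multiplicity-insert : ∀ {C} T v x (col : Fin n → Fin C) c₀ c →
    multiplicity T (updateAt col v λ _ → c₀) x c ≡ indicator (N T x v ∧ does (c₀ ≟ c)) + multiplicity (T - v) col x c
  multiplicity-insert T v x col c₀ c = begin
    count P                                            ≡⟨ count-remove P v ⟩
    indicator (P v) + count (P - v)                    ≡⟨ cong₂ _+_ (cong (λ c′ → indicator (N T x v ∧ does (c′ ≟ c))) (updateAt-updates v col))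
                                                                    (count-cong same) ⟩
    indicator (N T x v ∧ does (c₀ ≟ c)) + multiplicity (T - v) col x c ∎
    where
    open ≡-Reasoning
    P : Fin n → Bool
    P y = N T x y ∧ does (updateAt col v (λ _ → c₀) y ≟ c)
    same : ∀ y → (P - v) y ≡ N (T - v) x y ∧ does (col y ≟ c)
    same y with v ≟ y
    ... | yes refl = refl
    ... | no v≢y = cong (λ c′ → N T x y ∧ does (c′ ≟ c)) (updateAt-minimal y v col (v≢y ∘ ≡.sym))

  odd-insert-kept : ∀ {C} T v x (col : Fin n → Fin C) c₀ c → (N T x v ≡ true → c₀ ≢ c) →
    multiplicity (T - v) col x c % 2 ≡ 1 → multiplicity T (updateAt col v λ _ → c₀) x c % 2 ≡ 1
  odd-insert-kept T v x col c₀ c c₀-unseen odd =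
    trans (cong (_% 2) (trans (multiplicity-insert T v x col c₀ c) (cong (_+ multiplicity (T - v) col x c) (uncounted (N T x v) c₀-unseen)))) odd
    where
    uncounted : ∀ b → (b ≡ true → c₀ ≢ c) → indicator (b ∧ does (c₀ ≟ c)) ≡ 0
    uncounted false _        = refl
    uncounted true  c₀-not-c = cong indicator (dec-false (c₀ ≟ c) (c₀-not-c refl))

  odd-insert-only : ∀ {C} T v x (col : Fin n → Fin C) c₀ → (∀ y → N (T - v) x y ≡ false) → HasNeighbour T x →
    multiplicity T (updateAt col v λ _ → c₀) x c₀ % 2 ≡ 1
  odd-insert-only T v x col c₀ isolated (y , xy) =
    trans (cong (_% 2) (multiplicity-insert T v x col c₀ c₀))
          (cong₂ (λ a m → (indicator a + m) % 2) (∧-true⁺ xv (dec-true (c₀ ≟ c₀) refl)) (count-none none))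
    where
    none : ∀ z → N (T - v) x z ∧ does (col z ≟ c₀) ≡ false
    none z rewrite isolated z = refl
    xv : N T x v ≡ true
    xv with y ≟ v
    ... | yes refl = xy
    ... | no y≢v   = contradiction (trans (≡.sym (N-remove T v xy y≢v)) (isolated y)) λ ()

  OddColoringOn-insert : ∀ {C} T v → degIn (adj G) T v + degIn (adj G) T v < C →
    OddUnderEveryProper C T v → OddColoringOn (T - v) C → OddColoringOn T C
  OddColoringOn-insert {C} T v 2deg<C v-odd χ = record
    { color = color′ ; proper = proper′ ; oddColor = updateAt oddColor-off-v v (λ _ → c-v) ; odd = odd′ }
    where
    open OddColoringOn χ

    c₀-free : ∃ λ c → ∀ u → N T v u ≡ true → c ≢ color u × c ≢ oddColor u
    c₀-free = free-colour (N T v) color oddColor 2deg<C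

    c₀ : Fin C
    c₀ = proj₁ c₀-free

    color′ : Fin n → Fin C
    color′ = updateAt color v λ _ → c₀

    proper′ : ProperOn T color′
    proper′ = ProperOn-insert T v color c₀ (λ u vu → proj₁ (proj₂ c₀-free u vu)) proper

    c-v : Fin C
    c-v = proj₁ (v-odd color′ proper′)

    -- In the second case v is the only neighbour of x, so c₀ occurs exactly once around x.
    oddColor-off-v : Fin n → Fin C
    oddColor-off-v x with any? (λ y → N (T - v) x y Bool.≟ true)
    ... | yes _ = oddColor x
    ... | no  _ = c₀

    odd-off-v : ∀ x → T x ≡ true → x ≢ v → HasNeighbour T x → multiplicity T color′ x (oddColor-off-v x) % 2 ≡ 1
    odd-off-v x Tx x≢v has with any? (λ y → N (T - v) x y Bool.≟ true)
    ... | yes has′     = odd-insert-kept T v x color c₀ (oddColor x)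
                           (λ xv → proj₂ (proj₂ c₀-free x (N-sym T Tx xv))) (odd x (y∈p⇒y∈p-x T v Tx x≢v) has′)
    ... | no  isolated = odd-insert-only T v x color c₀ (λ y → Bool.¬-not λ xy → isolated (y , xy)) has

    odd′ : ∀ x → T x ≡ true → HasNeighbour T x →
      multiplicity T color′ x (updateAt oddColor-off-v v (λ _ → c-v) x) % 2 ≡ 1
    odd′ x Tx has with x ≟ v
    ... | yes refl rewrite updateAt-updates x {λ _ → c-v} oddColor-off-v = proj₂ (v-odd color′ proper′) has
    ... | no  x≢v  rewrite updateAt-minimal x v {λ _ → c-v} oddColor-off-v x≢v = odd-off-v x Tx x≢v has

-- Maximal degeneracy of induced subgraphs

module _ {n} (G : Graph n) (k : ℕ) where

  MaximalDegenerateOn : (Fin n → Bool) → Set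
  MaximalDegenerateOn T = DegenerateOn k (adj G) T ×
    (∀ x y → T x ≡ true → T y ≡ true → x ≢ y → adj G x y ≡ false → ¬ DegenerateOn k (addEdge (adj G) x y) T)

  MaximalDegenerateOn-remove : ∀ {T v} → MaximalDegenerateOn T → degIn (adj G) T v ≤ k → MaximalDegenerateOn (T - v)
  MaximalDegenerateOn-remove {T} {v} (D , maximal) deg≤k = DegenerateOn-⊆ k (p-x⊆p T v) D , maximal-remove
    where
    maximal-remove : ∀ x y → (T - v) x ≡ true → (T - v) y ≡ true → x ≢ y → adj G x y ≡ false →
      ¬ DegenerateOn k (addEdge (adj G) x y) (T - v)
    maximal-remove x y T-v∋x T-v∋y x≢y Axy D′ =
      maximal x y (p-x⊆p T v x T-v∋x) (p-x⊆p T v y T-v∋y) x≢y Axy (DegenerateOn-insert k v v-low D′)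
      where
      v-low : ∀ S → S ⊆ T → S v ≡ true → degIn (addEdge (adj G) x y) S v ≤ k
      v-low S S⊆T _ = begin
        degIn (addEdge (adj G) x y) S v  ≡⟨ degIn-addEdge-away (adj G) S (y∈p-x⇒x≢y T v T-v∋x) (y∈p-x⇒x≢y T v T-v∋y) ⟩
        degIn (adj G) S v                ≤⟨ degIn-mono (adj G) v S⊆T ⟩
        degIn (adj G) T v                ≤⟨ deg≤k ⟩
        k                                ∎
        where open ≤-Reasoning

  small⇒clique : ∀ {T} → MaximalDegenerateOn T → count T ≤ suc k → IsClique G T
  small⇒clique (_ , maximal) |T|≤1+k x y Tx Ty x≢y with adj G x y in Axy
  ... | true  = refl
  ... | false = contradiction (DegenerateOn-small k (addEdge-irrefl (adj G) (irrefl G) x≢y) |T|≤1+k)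
                              (maximal x y Tx Ty x≢y Axy)

  low-degree⇒adjacent : ∀ {T v y} → MaximalDegenerateOn T → T v ≡ true → degIn (adj G) T v < k →
    T y ≡ true → v ≢ y → adj G v y ≡ true
  low-degree⇒adjacent {T} {v} {y} (D , maximal) Tv deg<k Ty v≢y with adj G v y in Avy
  ... | true  = refl
  ... | false = contradiction
      (DegenerateOn-insert k v v-low (DegenerateOn-addEdge-outside k (x∉p-x T v) (DegenerateOn-⊆ k (p-x⊆p T v) D)))
      (maximal v y Tv Ty v≢y Avy)
    where
    v-low : ∀ S → S ⊆ T → S v ≡ true → degIn (addEdge (adj G) v y) S v ≤ k
    v-low S S⊆T _ = ≤-trans (degIn-addEdge-≤ (adj G) S v≢y) (≤-trans (s≤s (degIn-mono (adj G) v S⊆T)) deg<k)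

  large⇒degree≡k : ∀ {T v} → MaximalDegenerateOn T → T v ≡ true → degIn (adj G) T v ≤ k →
    suc (suc k) ≤ count T → degIn (adj G) T v ≡ k
  large⇒degree≡k {T} {v} M Tv deg≤k 2+k≤|T| = ≤-antisym deg≤k (≮⇒≥ deg≮k)
    where
    deg≮k : ¬ degIn (adj G) T v < k
    deg≮k deg<k = <-asym deg<k (s≤s⁻¹ (begin
      suc (suc k)                                ≤⟨ 2+k≤|T| ⟩
      count T                                    ≤⟨ count-mono closed ⟩
      count (λ w → N G T v w ∨ does (v ≟ w))     ≤⟨ count-∨-singleton (N G T v) v ⟩
      suc (degIn (adj G) T v)                    ∎))
      where
      open ≤-Reasoning
      closed : T ⊆ λ w → N G T v w ∨ does (v ≟ w)
      closed w Tw with v ≟ w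
      ... | yes _    = ∨-zeroʳ _
      ... | no  v≢w  = trans (∨-identityʳ _) (∧-true⁺ Tw (low-degree⇒adjacent M Tv deg<k Tw v≢w))

  oddColoringOn : ∀ {C} → k + k < C → k % 2 ≡ 1 →
    ∀ m T → count T ≡ m → MaximalDegenerateOn T → OddColoringOn G T C
  oddColoringOn {C} 2k<C _ ℕ.zero T |T|≡0 _ = record
    { color = λ _ → c ; proper = λ _ _ Tx → contradiction Tx ∉T ; oddColor = λ _ → c ; odd = λ _ Tx → contradiction Tx ∉T }
    where
    c : Fin C
    c = fromℕ< (≤-<-trans z≤n 2k<C)
    ∉T : ∀ {x} → T x ≢ true
    ∉T Tx = 0≢1+n (trans (≡.sym |T|≡0) (count-remove-∈ T Tx))
  oddColoringOn {C} 2k<C k-odd (suc m) T |T|≡1+m M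
    with proj₁ M T (λ _ Tx → Tx) (count-pos⇒∃ (subst (0 <_) (≡.sym |T|≡1+m) (s≤s z≤n)))
  ... | v , Tv , deg≤k =
    OddColoringOn-insert G T v (≤-<-trans (+-mono-≤ deg≤k deg≤k) 2k<C) v-odd
      (oddColoringOn 2k<C k-odd m (T - v) |T-v|≡m (MaximalDegenerateOn-remove M deg≤k))
    where
    |T-v|≡m : count (T - v) ≡ m
    |T-v|≡m = suc-injective (trans (≡.sym (count-remove-∈ T Tv)) |T|≡1+m)
    v-odd : OddUnderEveryProper G C T v
    v-odd with count T ≤? suc k
    ... | yes small = clique⇒OddUnderEveryProper G T v (small⇒clique M small)
    ... | no  large = odd-degree⇒OddUnderEveryProper G T v
                        (subst (λ d → d % 2 ≡ 1) (≡.sym (large⇒degree≡k M Tv deg≤k (≰⇒> large))) k-odd)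

k+k<2k+1 : ∀ k → k + k < 2 * k + 1
k+k<2k+1 k = ≤-reflexive (trans (cong (λ m → suc (k + m)) (≡.sym (+-identityʳ k))) (+-comm 1 (2 * k)))

proposition4 : (k : ℕ) → k % 2 ≡ 1 → (n : ℕ) → (G : Graph n) →
    MaximalDegenerate k G → OddChromaticAtMost G (2 * k + 1)
proposition4 k k-odd n G (degenerate , maximal) = record
  { color  = color
  ; proper = λ x y → proper x y refl refl
  ; odd    = λ x has → oddColor x , odd x refl has
  }
  where
  maximalOnAll : MaximalDegenerateOn G k (λ _ → true)
  maximalOnAll = (λ S _ → degenerate S) , λ x y _ _ x≢y Axy D → maximal x y x≢y Axy λ S → D S λ _ _ → refl
  open OddColoringOn (oddColoringOn G k (k+k<2k+1 k) k-odd _ (λ _ → true) refl maximalOnAll)
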